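{- Let $\phi_P$ be a prime formula and let $\phi$ be a formula logically equivalent to $\phi_P$ (over the same set of variables). Then (1) if $\phi$ is separable, $\phi_P$ is also separable, and (2) if $\phi$ is renamable partially Horn, $\phi_P$ is also renamable partially Horn.
   Context: Formulas are CNF: conjunctions of clauses, each a disjunction of literals of distinct variables. A sub-clause of a clause $C$ is any non-empty clause obtained by deleting at least one literal of $C$. A clause $C$ of $\phi$ is a prime implicate of $\phi$ if no sub-clause of $C$ is logically implied by $\phi$; $\phi$ is prime if all its clauses are prime implicates of it. A formula over $V$ is separable if $V$ can be partitioned into two non-empty disjoint sets so that no clause contains variables from both. A formula over $V$ is partially Horn if there is a non-empty $V_0\subseteq V$ such that every clause containing only variables from $V_0$ has at most one positive literal and variables of $V_0$ appear only negatively in clauses also containing variables outside $V_0$; it is renamable partially Horn if after swapping $x\leftrightarrow\neg x$ for all $x$ in some subset of variables it becomes partially Horn. -}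

module Defs where

open import Data.Nat using (ℕ; _≤_; _<_; zero; suc)
open import Data.Fin using (Fin)
open import Data.Bool using (Bool; true; false; not; if_then_else_)
open import Data.Product using (Σ; ∃; ∃-syntax; _×_; _,_; proj₁; proj₂)
open import Data.Sum using (_⊎_)
open import Data.List using (List; []; _∷_; map; length)
open import Data.List.Relation.Unary.All using (All)
open import Data.List.Relation.Unary.Any using (Any)
open import Data.List.Relation.Unary.Unique.Propositional using (Unique)
open import Data.List.Relation.Binary.Sublist.Propositional using (_⊆_)
open import Relation.Binary.PropositionalEquality using (_≡_)
open import Relation.Nullary using (¬_)
open import Function.Bundles using (_⇔_)

-- Variables of a formula over V are Fin n (V = Fin n).
-- A literal is a variable together with a polarity (true = positive, false = negated).
Literal : ℕ → Set
Literal n = Fin n × Bool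

var : ∀ {n} → Literal n → Fin n
var = proj₁

positive : ∀ {n} → Literal n → Bool
positive = proj₂

Clause : ℕ → Set
Clause n = List (Literal n)

Formula : ℕ → Set
Formula n = List (Clause n)

WFClause : ∀ {n} → Clause n → Set
WFClause C = ¬ (C ≡ []) × Unique (map var C)

WFFormula : ∀ {n} → Formula n → Set
WFFormula φ = All WFClause φ

Assignment : ℕ → Set
Assignment n = Fin n → Bool

SatLit : ∀ {n} → Assignment n → Literal n → Set
SatLit a l = a (var l) ≡ positive l

SatClause : ∀ {n} → Assignment n → Clause n → Set
SatClause a C = Any (SatLit a) C

SatFormula : ∀ {n} → Assignment n → Formula n → Set
SatFormula a φ = All (SatClause a) φ

Implies : ∀ {n} → Formula n → Clause n → Set
Implies φ C = ∀ a → SatFormula a φ → SatClause a C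

Equivalent : ∀ {n} → Formula n → Formula n → Set
Equivalent φ ψ = ∀ a → SatFormula a φ ⇔ SatFormula a ψ

SubClause : ∀ {n} → Clause n → Clause n → Set
SubClause D C = D ⊆ C × ¬ (D ≡ []) × length D < length C

PrimeImplicate : ∀ {n} → Formula n → Clause n → Set
PrimeImplicate φ C = Implies φ C × (∀ D → SubClause D C → ¬ Implies φ D)

Prime : ∀ {n} → Formula n → Set
Prime φ = All (PrimeImplicate φ) φ

-- subsets of V as characteristic functions
Subset : ℕ → Set
Subset n = Fin n → Bool

Separable : ∀ {n} → Formula n → Set
Separable {n} φ =
  Σ (Subset n) λ S →
    (∃[ x ] S x ≡ true) × (∃[ y ] S y ≡ false) ×
    All (λ C → All (λ l → S (var l) ≡ true) C ⊎ All (λ l → S (var l) ≡ false) C) φ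

numPositive : ∀ {n} → Clause n → ℕ
numPositive [] = 0
numPositive (l ∷ C) = if positive l then suc (numPositive C) else numPositive C

PartiallyHorn : ∀ {n} → Formula n → Set
PartiallyHorn {n} φ =
  Σ (Subset n) λ V₀ →
    (∃[ x ] V₀ x ≡ true) ×
    All (λ C →
          (All (λ l → V₀ (var l) ≡ true) C → numPositive C ≤ 1) ×
          (Any (λ l → V₀ (var l) ≡ false) C →
             All (λ l → V₀ (var l) ≡ true → positive l ≡ false) C)) φ

renameLit : ∀ {n} → Subset n → Literal n → Literal n
renameLit S (x , b) = x , (if S x then not b else b)

rename : ∀ {n} → Subset n → Formula n → Formula n
rename S φ = map (map (renameLit S)) φ

RenamablePartiallyHorn : ∀ {n} → Formula n → Set
RenamablePartiallyHorn {n} φ = Σ (Subset n) λ S → PartiallyHorn (rename S φ)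

-- Each property is witnessed by a way of combining two models a, b into a third: a separation
-- S takes a on S and b off S; a partially Horn set V takes a ∧ b on V and a off V.  The models
-- of φ, hence of the equivalent φP, are closed under it, and every literal true in the combined
-- model is true in a and lies in a part P of the literals, or is true in b and lies in a part Q.
-- Hence every implicate C of φP is implied by C ∩ P or by C ∩ Q, so primality forbids both to
-- be proper non-empty sub-clauses.  A clause violating the property yields such P and Q: the
-- literals on S and off S; for a Horn clause on V with positive literals on x and y, everything
-- but the positive x-literal against the negative literals and that x-literal; for a mixed
-- clause with a positive V-literal, the non-positive-V literals against the V-literals.
-- Renaming preserves primality and equivalence, which gives the renamable case.
module Submission where

open import Defs
open import Data.Nat using (ℕ)
open import Data.Product using (_×_)

open import Data.Bool using (Bool; true; false; not; _∧_)
open import Data.Bool.Properties using (not-involutive; not-¬; ¬-not; ∧-zeroʳ) renaming (_≟_ to _≟ᵇ_)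
open import Data.Empty using (⊥; ⊥-elim)
open import Data.Fin using (Fin) renaming (_≟_ to _≟ᶠ_)
open import Data.List using (List; []; _∷_; map; length; filter)
open import Data.List.Properties using (map-∘; map-cong; map-id; length-map; filter-some; filter-notAll)
open import Data.List.Relation.Binary.Sublist.Propositional.Properties using (filter-⊆)
  renaming (map⁺ to ⊆-map⁺)
open import Data.List.Relation.Unary.All as All using (All; []; _∷_; all?)
open import Data.List.Relation.Unary.All.Properties using (¬All⇒Any¬)
  renaming (map⁺ to All-map⁺; map⁻ to All-map⁻)
open import Data.List.Relation.Unary.Any as Any using (Any; here; there; any?)
open import Data.List.Relation.Unary.Any.Properties using (Any-⊎⁻; lookup-result)
  renaming (filter⁺ to Any-filter⁺; map⁺ to Any-map⁺; map⁻ to Any-map⁻)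
open import Data.List.Relation.Unary.AllPairs using (_∷_)
open import Data.List.Relation.Unary.Unique.Propositional using (Unique)
open import Data.Nat using (_≤_; _<_; s≤s; _≤?_)
open import Data.Nat.Properties using (≰⇒>; <⇒≢)
open import Data.Product using (∃-syntax; _,_; proj₁; proj₂)
open import Data.Sum using (_⊎_; inj₁; inj₂; [_,_]′)
open import Function using (_∘_; id)
open import Function.Bundles using (_⇔_; mk⇔; Equivalence)
open import Function.Construct.Composition using (_⇔-∘_)
open import Function.Construct.Symmetry using (⇔-sym)
open import Relation.Binary.PropositionalEquality
  using (_≡_; _≢_; refl; sym; trans; cong; subst; subst₂)
open import Relation.Nullary using (¬_; yes; no)
open import Relation.Nullary.Decidable using (decidable-stable; _→-dec_; ¬?)
open import Relation.Unary using (Pred; Decidable; ∁; _∩_)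
open import Level using (0ℓ)

private
  variable
    n : ℕ
    A : Set
    P Q : Pred A 0ℓ
    xs : List A
    a b : Assignment n
    l : Literal n
    C D : Clause n
    φ ψ : Formula n

Any-zipAll : All P xs → Any Q xs → Any (P ∩ Q) xs
Any-zipAll (p ∷ _) (here q) = here (p , q)
Any-zipAll (_ ∷ ps) (there qs) = there (Any-zipAll ps qs)

All⊎Any¬ : Decidable P → (xs : List A) → All P xs ⊎ Any (∁ P) xs
All⊎Any¬ P? xs with all? P? xs
... | yes all = inj₁ all
... | no ¬all = inj₂ (¬All⇒Any¬ P? xs ¬all)

Any-filter : (P? : Decidable P) → Any (P ∩ Q) xs → Any Q (filter P? xs)
Any-filter P? pq with Any-filter⁺ P? pq
... | inj₁ any = Any.map proj₂ any
... | inj₂ ¬p = ⊥-elim (¬p (proj₁ (lookup-result pq)))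

map-≢[] : {B : Set} {f : A → B} → xs ≢ [] → map f xs ≢ []
map-≢[] {xs = []} nonEmpty _ = nonEmpty refl

map-involutive : {f : A → A} → (∀ x → f (f x) ≡ x) → (xs : List A) → map f (map f xs) ≡ xs
map-involutive {f = f} inv xs = trans (sym (map-∘ xs)) (trans (map-cong inv xs) (map-id xs))

filter-subClause : {P : Pred (Literal n) 0ℓ} (P? : Decidable P) →
  Any P C → Any (∁ P) C → SubClause (filter P? C) C
filter-subClause {C = C} P? p ¬p =
  filter-⊆ P? C ,
  (λ empty → <⇒≢ (filter-some P? p) (sym (cong length empty))) ,
  filter-notAll P? C ¬p

subClause-map : (f : Literal n → Literal n) → SubClause D C → SubClause (map f D) (map f C)
subClause-map {D = D} {C = C} f (D⊆C , nonEmpty , shorter) =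
  ⊆-map⁺ f D⊆C ,
  map-≢[] nonEmpty ,
  subst₂ _<_ (sym (length-map f D)) (sym (length-map f C)) shorter

satClause? : (a : Assignment n) → Decidable (SatClause a)
satClause? a = any? (λ l → a (var l) ≟ᵇ positive l)

Inside Outside : Subset n → Pred (Literal n) 0ℓ
Inside S l = S (var l) ≡ true
Outside S l = S (var l) ≡ false

inside? : (S : Subset n) → Decidable (Inside S)
inside? S l = S (var l) ≟ᵇ true

outside? : (S : Subset n) → Decidable (Outside S)
outside? S l = S (var l) ≟ᵇ false

Combination : ℕ → Set
Combination n = Assignment n → Assignment n → Assignment n

ClosedUnder : Formula n → Combination n → Set
ClosedUnder φ _⊕_ = ∀ a b → SatFormula a φ → SatFormula b φ → SatFormula (a ⊕ b) φ

SplitsAlong : Combination n → (P Q : Pred (Literal n) 0ℓ) → Set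
SplitsAlong _⊕_ P Q =
  ∀ a b {l} → SatLit (a ⊕ b) l → (P l × SatLit a l) ⊎ (Q l × SatLit b l)

closedUnder-equivalent : {_⊕_ : Combination n} → Equivalent φ ψ → ClosedUnder φ _⊕_ → ClosedUnder ψ _⊕_
closedUnder-equivalent φ≡ψ closed a b a⊨ψ b⊨ψ =
  Equivalence.to (φ≡ψ _) (closed a b (Equivalence.from (φ≡ψ a) a⊨ψ) (Equivalence.from (φ≡ψ b) b⊨ψ))

module _ {_⊕_ : Combination n} {P Q : Pred (Literal n) 0ℓ} (P? : Decidable P) (Q? : Decidable Q)
         (closed : ClosedUnder φ _⊕_) (splits : SplitsAlong _⊕_ P Q) where

  -- If a model a falsifies the P-part of C, then every model b satisfies its Q-part,
  -- since some literal of C is true in a ⊕ b.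
  implicate-split : Implies φ C → ¬ Implies φ (filter P? C) → ¬ Implies φ (filter Q? C) → ⊥
  implicate-split {C = C} φ⊨C φ⊭CP φ⊭CQ =
    φ⊭CP λ a a⊨φ → decidable-stable (satClause? a (filter P? C)) λ a⊭CP →
      φ⊭CQ λ b b⊨φ →
        [ ⊥-elim ∘ a⊭CP ∘ Any-filter P? , Any-filter Q? ]′
          (Any-⊎⁻ (Any.map (splits a b) (φ⊨C (a ⊕ b) (closed a b a⊨φ b⊨φ))))

  primeImplicate-unsplit : PrimeImplicate φ C →
    Any P C → Any (∁ P) C → Any Q C → Any (∁ Q) C → ⊥
  primeImplicate-unsplit (φ⊨C , minimal) p ¬p q ¬q =
    implicate-split φ⊨C
      (minimal _ (filter-subClause P? p ¬p))
      (minimal _ (filter-subClause Q? q ¬q))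

module Separation (S : Subset n) where

  SeparatedBy : Clause n → Set
  SeparatedBy C = All (Inside S) C ⊎ All (Outside S) C

  select : Combination n
  select a b x with S x
  ... | true = a x
  ... | false = b x

  select-splits : SplitsAlong select (Inside S) (Outside S)
  select-splits a b {x , _} s with S x
  ... | true = inj₁ (refl , s)
  ... | false = inj₂ (refl , s)

  select-inside : Inside S l → SatLit a l → SatLit (select a b) l
  select-inside {l = x , _} inside s with S x
  ... | true = s

  select-outside : Outside S l → SatLit b l → SatLit (select a b) l
  select-outside {l = x , _} outside s with S x
  ... | false = s

  select-closed : All SeparatedBy φ → ClosedUnder φ select
  select-closed [] a b [] [] = []
  select-closed (inj₁ inside ∷ sep) a b (sa ∷ sas) (_ ∷ sbs) =
    Any.map (λ (i , s) → select-inside i s) (Any-zipAll inside sa) ∷ select-closed sep a b sas sbs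
  select-closed (inj₂ outside ∷ sep) a b (_ ∷ sas) (sb ∷ sbs) =
    Any.map (λ (o , s) → select-outside o s) (Any-zipAll outside sb) ∷ select-closed sep a b sas sbs

  prime-separated : ClosedUnder φ select → PrimeImplicate φ C → SeparatedBy C
  prime-separated {C = C} closed prime with All⊎Any¬ (inside? S) C
  ... | inj₁ inside = inj₁ inside
  ... | inj₂ ¬inside with All⊎Any¬ (outside? S) C
  ...   | inj₁ outside = inj₂ outside
  ...   | inj₂ ¬outside = ⊥-elim (primeImplicate-unsplit
            (inside? S) (outside? S) closed select-splits prime
            (Any.map ¬-not ¬outside) ¬inside (Any.map ¬-not ¬inside) ¬outside)

separable-prime : {φP : Formula n} → Prime φP → Equivalent φ φP → Separable φ → Separable φP
separable-prime prime φ≡φP (S , x , y , sep) =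
  S , x , y , All.map (prime-separated (closedUnder-equivalent φ≡φP (select-closed sep))) prime
  where open Separation S

numPositive≤0 : numPositive C ≤ 0 → All (λ l → positive l ≡ false) C
numPositive≤0 {C = []} _ = []
numPositive≤0 {C = (_ , false) ∷ C} h = refl ∷ numPositive≤0 h

numPositive≥1 : 1 ≤ numPositive C → Any (λ l → positive l ≡ true) C
numPositive≥1 {C = (_ , true) ∷ _} _ = here refl
numPositive≥1 {C = (_ , false) ∷ _} h = there (numPositive≥1 h)

numPositive≥2 : Unique (map var C) → 2 ≤ numPositive C →
  ∃[ x ] Any (λ l → positive l ≡ true × var l ≡ x) C × Any (λ l → positive l ≡ true × var l ≢ x) C
numPositive≥2 {C = (x , true) ∷ C} (x∉C ∷ _) (s≤s h) =
  x , here (refl , refl) ,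
  there (Any.map (λ (x≢y , pos) → pos , x≢y ∘ sym) (Any-zipAll (All-map⁻ x∉C) (numPositive≥1 h)))
numPositive≥2 {C = (_ , false) ∷ C} (_ ∷ unique) h with numPositive≥2 unique h
... | x , px , py = x , there px , there py

antecedent-true : {u v : Bool} → ¬ (u ≡ true → v ≡ false) → u ≡ true
antecedent-true {true} _ = refl
antecedent-true {false} h = ⊥-elim (h λ ())

AvoidsPositive IsPositiveOnly : Fin n → Pred (Literal n) 0ℓ
AvoidsPositive x l = positive l ≡ true → var l ≢ x
IsPositiveOnly x l = positive l ≡ true → var l ≡ x

avoidsPositive? : (x : Fin n) → Decidable (AvoidsPositive x)
avoidsPositive? x l = (positive l ≟ᵇ true) →-dec ¬? (var l ≟ᶠ x)

isPositiveOnly? : (x : Fin n) → Decidable (IsPositiveOnly x)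
isPositiveOnly? x l = (positive l ≟ᵇ true) →-dec (var l ≟ᶠ x)

module PartialHorn (V : Subset n) where

  NegativeInside : Pred (Literal n) 0ℓ
  NegativeInside l = Inside V l → positive l ≡ false

  HornOn : Clause n → Set
  HornOn C = (All (Inside V) C → numPositive C ≤ 1) × (Any (Outside V) C → All NegativeInside C)

  meet : Combination n
  meet a b x with V x
  ... | true = a x ∧ b x
  ... | false = a x

  data MeetSat (a b : Assignment n) (l : Literal n) : Set where
    positive-both : Inside V l → positive l ≡ true → SatLit a l → SatLit b l → MeetSat a b l
    negative-either : Inside V l → positive l ≡ false → SatLit a l ⊎ SatLit b l → MeetSat a b l
    outside-left : Outside V l → SatLit a l → MeetSat a b l

  meet-satLit : ∀ a b {l} → SatLit (meet a b) l → MeetSat a b l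
  meet-satLit a b {x , pol} s with V x in vx
  ... | false = outside-left vx s
  ... | true with a x in ax | b x in bx
  ...   | true | true = positive-both vx (sym s) (trans ax s) (trans bx s)
  ...   | false | _ = negative-either vx (sym s) (inj₁ (trans ax s))
  ...   | true | false = negative-either vx (sym s) (inj₂ (trans bx s))

  meet-both : SatLit a l → SatLit b l → SatLit (meet a b) l
  meet-both {l = x , true} sa sb with V x
  ... | true rewrite sa | sb = refl
  ... | false = sa
  meet-both {l = x , false} sa sb with V x
  ... | true rewrite sa = refl
  ... | false = sa

  meet-left : NegativeInside l → SatLit a l → SatLit (meet a b) l
  meet-left {l = x , pol} neg s with V x
  ... | false = s
  ... | true with refl ← neg refl rewrite s = refl

  meet-right : Inside V l → positive l ≡ false → SatLit b l → SatLit (meet a b) l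
  meet-right {l = x , .false} {a = a} inside refl sb rewrite inside | sb = ∧-zeroʳ (a x)

  meet-horn : All (Inside V) D → numPositive D ≤ 1 → SatClause a D → SatClause b D → SatClause (meet a b) D
  meet-horn {D = (_ , true) ∷ D} _ _ (here sa) (here sb) = here (meet-both sa sb)
  meet-horn {D = (_ , true) ∷ D} (_ ∷ inside) (s≤s h) (here _) (there sb) =
    there (Any.map (λ ((i , neg) , s) → meet-right i neg s)
                   (Any-zipAll (All.zip (inside , numPositive≤0 h)) sb))
  meet-horn {D = (_ , true) ∷ D} _ (s≤s h) (there sa) _ =
    there (Any.map (λ (neg , s) → meet-left (λ _ → neg) s) (Any-zipAll (numPositive≤0 h) sa))
  meet-horn {D = (_ , false) ∷ D} _ _ (here sa) _ = here (meet-left (λ _ → refl) sa)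
  meet-horn {D = (_ , false) ∷ D} (i ∷ _) _ (there _) (here sb) = here (meet-right i refl sb)
  meet-horn {D = (_ , false) ∷ D} (_ ∷ inside) h (there sa) (there sb) =
    there (meet-horn inside h sa sb)

  meet-closed : All HornOn φ → ClosedUnder φ meet
  meet-closed [] a b [] [] = []
  meet-closed {φ = D ∷ _} ((horn , mixed) ∷ hs) a b (sa ∷ sas) (sb ∷ sbs) =
    clause ∷ meet-closed hs a b sas sbs
    where
      clause : SatClause (meet a b) D
      clause with All⊎Any¬ (inside? V) D
      ... | inj₁ inside = meet-horn inside (horn inside) sa sb
      ... | inj₂ ¬inside =
        Any.map (λ (neg , s) → meet-left neg s) (Any-zipAll (mixed (Any.map ¬-not ¬inside)) sa)

  negativeInside? : Decidable NegativeInside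
  negativeInside? l = inside? V l →-dec (positive l ≟ᵇ false)

  meet-splits-mixed : SplitsAlong meet NegativeInside (Inside V)
  meet-splits-mixed a b s with meet-satLit a b s
  ... | positive-both inside _ _ sb = inj₂ (inside , sb)
  ... | negative-either _ neg (inj₁ sa) = inj₁ ((λ _ → neg) , sa)
  ... | negative-either inside _ (inj₂ sb) = inj₂ (inside , sb)
  ... | outside-left outside sa = inj₁ ((λ inside → ⊥-elim (not-¬ outside inside)) , sa)

  meet-splits-horn : ∀ {x} → V x ≡ true → SplitsAlong meet (AvoidsPositive x) (IsPositiveOnly x)
  meet-splits-horn {x} vx a b {l} s with meet-satLit a b s | var l ≟ᶠ x
  ... | positive-both _ _ _ sb | yes eq = inj₂ ((λ _ → eq) , sb)
  ... | positive-both _ _ sa _ | no neq = inj₁ ((λ _ → neq) , sa)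
  ... | negative-either _ neg (inj₁ sa) | _ = inj₁ ((λ pos → ⊥-elim (not-¬ neg pos)) , sa)
  ... | negative-either _ neg (inj₂ sb) | _ = inj₂ ((λ pos → ⊥-elim (not-¬ neg pos)) , sb)
  ... | outside-left outside sa | _ =
    inj₁ ((λ _ eq → not-¬ outside (subst (λ y → V y ≡ true) (sym eq) vx)) , sa)

  prime-horn : ClosedUnder φ meet → Unique (map var C) → PrimeImplicate φ C → HornOn C
  prime-horn {C = C} closed unique prime = horn , mixed
    where
      horn : All (Inside V) C → numPositive C ≤ 1
      horn inside with numPositive C ≤? 1
      ... | yes h = h
      ... | no h with numPositive≥2 unique (≰⇒> h)
      ...   | x , px , py = ⊥-elim (primeImplicate-unsplit
                (avoidsPositive? x) (isPositiveOnly? x)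
                closed (meet-splits-horn vx) prime
                (Any.map (λ (_ , neq) _ → neq) py) (Any.map (λ (pos , eq) avoid → avoid pos eq) px)
                (Any.map (λ (_ , eq) _ → eq) px) (Any.map (λ (pos , neq) only → neq (only pos)) py))
        where
          vx : V x ≡ true
          vx = All.lookupWith (λ { inside (_ , refl) → inside }) inside px

      mixed : Any (Outside V) C → All NegativeInside C
      mixed outside with All⊎Any¬ negativeInside? C
      ... | inj₁ neg = neg
      ... | inj₂ ¬neg = ⊥-elim (primeImplicate-unsplit negativeInside? (inside? V)
              closed meet-splits-mixed prime
              (Any.map (λ out inside → ⊥-elim (not-¬ out inside)) outside) ¬neg
              (Any.map antecedent-true ¬neg) (Any.map not-¬ outside))

partiallyHorn-prime : {φP : Formula n} → WFFormula φP → Prime φP → Equivalent φ φP →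
  PartiallyHorn φ → PartiallyHorn φP
partiallyHorn-prime {φP = φP} wf prime φ≡φP (V , x , horn) =
  V , x , All.zipWith (λ ((_ , unique) , p) → prime-horn closed unique p) (wf , prime)
  where
    open PartialHorn V
    closed : ClosedUnder φP meet
    closed = closedUnder-equivalent φ≡φP (meet-closed horn)

module Renaming (S : Subset n) where

  flipOn : Assignment n → Assignment n
  flipOn a x with S x
  ... | true = not (a x)
  ... | false = a x

  satLit-rename : SatLit a (renameLit S l) ⇔ SatLit (flipOn a) l
  satLit-rename {a = a} {l = x , pol} with S x
  ... | true = mk⇔ (λ e → trans (cong not e) (not-involutive pol))
                   (λ e → trans (sym (not-involutive (a x))) (cong not e))
  ... | false = mk⇔ id id

  satClause-rename : SatClause a (map (renameLit S) C) ⇔ SatClause (flipOn a) C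
  satClause-rename = mk⇔ (Any.map (Equivalence.to satLit-rename) ∘ Any-map⁻)
                         (Any-map⁺ ∘ Any.map (Equivalence.from satLit-rename))

  satFormula-rename : SatFormula a (rename S φ) ⇔ SatFormula (flipOn a) φ
  satFormula-rename = mk⇔ (All.map (Equivalence.to satClause-rename) ∘ All-map⁻)
                          (All-map⁺ ∘ All.map (Equivalence.from satClause-rename))

  equivalent-rename : Equivalent φ ψ → Equivalent (rename S φ) (rename S ψ)
  equivalent-rename φ≡ψ a = ⇔-sym satFormula-rename ⇔-∘ (φ≡ψ (flipOn a) ⇔-∘ satFormula-rename)

  implies-rename : Implies φ C → Implies (rename S φ) (map (renameLit S) C)
  implies-rename φ⊨C a a⊨φ =
    Equivalence.from satClause-rename (φ⊨C (flipOn a) (Equivalence.to satFormula-rename a⊨φ))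

  renameLit-involutive : ∀ l → renameLit S (renameLit S l) ≡ l
  renameLit-involutive (x , pol) with S x
  ... | true = cong (x ,_) (not-involutive pol)
  ... | false = refl

  rename-involutive : ∀ φ → rename S (rename S φ) ≡ φ
  rename-involutive = map-involutive (map-involutive renameLit-involutive)

  primeImplicate-rename : PrimeImplicate φ C → PrimeImplicate (rename S φ) (map (renameLit S) C)
  primeImplicate-rename {φ = φ} {C = C} (φ⊨C , minimal) =
    implies-rename φ⊨C ,
    λ D sub ⊨D → minimal (map (renameLit S) D)
      (subst (SubClause _) (map-involutive renameLit-involutive C) (subClause-map (renameLit S) sub))
      (subst (λ χ → Implies χ _) (rename-involutive φ) (implies-rename ⊨D))

  prime-rename : Prime φ → Prime (rename S φ)
  prime-rename prime = All-map⁺ (All.map primeImplicate-rename prime)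

  wfFormula-rename : WFFormula φ → WFFormula (rename S φ)
  wfFormula-rename = All-map⁺ ∘ All.map λ {C} (nonEmpty , unique) →
    map-≢[] nonEmpty , subst Unique (map-∘ C) unique

renamablePartiallyHorn-prime : {φP : Formula n} → WFFormula φP → Prime φP → Equivalent φ φP →
  RenamablePartiallyHorn φ → RenamablePartiallyHorn φP
renamablePartiallyHorn-prime wf prime φ≡φP (S , horn) =
  S , partiallyHorn-prime (wfFormula-rename wf) (prime-rename prime) (equivalent-rename φ≡φP) horn
  where open Renaming S

-- Only the clauses of φP need distinct variables (to find two distinct positive literals).
proposition4p10 : (n : ℕ) (φP φ : Formula n) →
    WFFormula φP → WFFormula φ → Prime φP → Equivalent φ φP →
    (Separable φ → Separable φP) × (RenamablePartiallyHorn φ → RenamablePartiallyHorn φP)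
proposition4p10 n φP φ wfP _ prime φ≡φP =
  separable-prime prime φ≡φP , renamablePartiallyHorn-prime wfP prime φ≡φP
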